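{- Let $G=(V,E)$ be a finite simple graph. For every integer $i\ge 0$ with $i\neq |V|$, \[ D^{(i)}(G,x)=\frac{1+x}{|V|-i}\,D^{(i+1)}(G,x)+\frac{1}{|V|-i}\,A^{(i)}(G,x). \]
   Context: The domination polynomial of $G=(V,E)$ is $D(G,x)=\sum_{W\subseteq V,\ N_G[W]=V}x^{|W|}$, where $N_G[W]$ is the closed neighborhood of $W$; the graph with no vertices has $D=1$. Define \[ A(G,x)=\sum_{v\in V}\big(D(G-v,x)-D(G/v,x)-D(G-N[v],x)\big), \] where: - $G-v$ deletes $v$. - $G/v$ deletes $v$ and adds edges between all pairs of non-adjacent neighbors of $v$. - $G-N[v]$ deletes the closed neighborhood of $v$. $D^{(i)}$ and $A^{(i)}$ denote $i$-th derivatives with respect to $x$. -}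

module Defs where

open import Data.Nat as ℕ using (ℕ; zero; suc)
open import Data.Integer as ℤ using (ℤ; +_; _+_; _-_; _*_)
open import Data.Bool using (Bool; true; false; not; _∧_; _∨_; if_then_else_)
open import Data.Fin using (Fin; _≟_)
open import Data.Vec using (Vec; []; _∷_; lookup; tabulate; replicate)
open import Data.List using (List; []; _∷_; map; _++_; allFin; foldr)
open import Relation.Nullary.Decidable using (⌊_⌋)
open import Relation.Binary.PropositionalEquality using (_≡_)

record SimpleGraph (n : ℕ) : Set where
  field
    adj    : Fin n → Fin n → Bool
    sym    : ∀ u v → adj u v ≡ adj v u
    irrefl : ∀ v → adj v v ≡ false
open SimpleGraph public

-- A graph presented as a vertex subset S ⊆ Fin n together with an adjacency
-- relation (the graph is the one induced on S).
Adj : ℕ → Set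
Adj n = Fin n → Fin n → Bool

VSet : ℕ → Set
VSet n = Vec Bool n

allSubsets : (n : ℕ) → List (VSet n)
allSubsets zero    = [] ∷ []
allSubsets (suc n) = map (false ∷_) (allSubsets n) ++ map (true ∷_) (allSubsets n)

card : ∀ {n} → VSet n → ℕ
card []           = 0
card (true  ∷ bs) = suc (card bs)
card (false ∷ bs) = card bs

allL : ∀ {A : Set} → (A → Bool) → List A → Bool
allL p = foldr (λ x acc → p x ∧ acc) true

anyL : ∀ {A : Set} → (A → Bool) → List A → Bool
anyL p = foldr (λ x acc → p x ∨ acc) false

countL : ∀ {A : Set} → (A → Bool) → List A → ℕ
countL p = foldr (λ x acc → if p x then suc acc else acc) 0

_==ℕ_ : ℕ → ℕ → Bool
zero  ==ℕ zero  = true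
zero  ==ℕ suc _ = false
suc _ ==ℕ zero  = false
suc m ==ℕ suc n = m ==ℕ n

isDominating : ∀ {n} → Adj n → VSet n → VSet n → Bool
isDominating {n} a S W =
  allL (λ u → not (lookup W u) ∨ lookup S u) (allFin n) ∧
  allL (λ u → not (lookup S u) ∨
         anyL (λ w → lookup W w ∧ (⌊ u ≟ w ⌋ ∨ a u w)) (allFin n)) (allFin n)

-- Polynomials with integer coefficients, as coefficient sequences
-- (coefficient of x^k at index k).
Poly : Set
Poly = ℕ → ℤ

domPolyS : ∀ {n} → Adj n → VSet n → Poly
domPolyS {n} a S k =
  + countL (λ W → isDominating a S W ∧ (card W ==ℕ k)) (allSubsets n)

D : ∀ {n} → SimpleGraph n → Poly
D {n} G = domPolyS (adj G) (replicate n true)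

D-del : ∀ {n} → SimpleGraph n → Fin n → Poly
D-del G v = domPolyS (adj G) (tabulate (λ u → not ⌊ u ≟ v ⌋))

-- G / v : delete v, and join all pairs of (distinct) non-adjacent neighbours of v
contractAdj : ∀ {n} → SimpleGraph n → Fin n → Adj n
contractAdj G v a b = adj G a b ∨ (adj G a v ∧ adj G b v ∧ not ⌊ a ≟ b ⌋)

D-con : ∀ {n} → SimpleGraph n → Fin n → Poly
D-con G v = domPolyS (contractAdj G v) (tabulate (λ u → not ⌊ u ≟ v ⌋))

D-delN : ∀ {n} → SimpleGraph n → Fin n → Poly
D-delN G v = domPolyS (adj G) (tabulate (λ u → not (⌊ u ≟ v ⌋ ∨ adj G u v)))

A : ∀ {n} → SimpleGraph n → Poly
A {n} G k = foldr (λ v acc → (D-del G v k - D-con G v k - D-delN G v k) + acc)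
                  (+ 0) (allFin n)

deriv : Poly → Poly
deriv p k = + suc k * p (suc k)

derivN : ℕ → Poly → Poly
derivN zero    p = p
derivN (suc i) p = derivN i (deriv p)

onePlusX : Poly → Poly
onePlusX p zero    = p zero
onePlusX p (suc k) = p (suc k) + p k

module Submission where

-- Write dₖ for the number of dominating sets of G of size k.  For a
-- vertex v and a set W ∌ v a case analysis on whether W meets N(v) gives
--   [W ≻ G-v] + [W ∪ {v} ≻ G] = [W ≻ G/v] + [W ≻ G-N[v]] + [W ≻ G].
-- Summing over all W of size m and then over all v, and double counting the pairs
-- (v, W) with v ∈ W resp. v ∉ W, yields the coefficient identity
--   n dₘ = (m+1) dₘ₊₁ + m dₘ + Aₘ,   i.e.   n·D = (1+x)·D′ + A.
-- Differentiating a relation  c·p = (1+x)·p′ + q  gives  (c-1)·p′ = (1+x)·p″ + q′,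
-- so by induction (n-i)·D⁽ⁱ⁾ = (1+x)·D⁽ⁱ⁺¹⁾ + A⁽ⁱ⁾ for every i.

open import Defs hiding (sym)
open import Data.Nat as ℕ using (ℕ; zero; suc)
import Data.Nat.Properties as ℕP
open import Data.Nat.Tactic.RingSolver using () renaming (solve-∀ to ℕ-solve)
open import Data.Integer using (ℤ; +_; _+_; _-_; _*_)
import Data.Integer.Properties as ℤP
open import Data.Integer.Tactic.RingSolver using (solve-∀)
open import Data.Bool as Bool using (Bool; true; false; not; _∧_; _∨_; if_then_else_)
open import Data.Bool.Properties using (∧-conicalˡ; ∧-conicalʳ; ∨-zeroʳ; ¬-not; ∧-zeroʳ; ∧-identityʳ)
open import Data.Fin as Fin using (Fin; _≟_)
import Data.Fin.Properties as FinP
open import Data.Vec using ([]; _∷_; lookup; tabulate; replicate; _[_]≔_)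
import Data.Vec.Properties as VecP
open import Data.List using (List; []; _∷_; map; _++_; allFin; foldr)
import Data.List.Properties as ListP
open import Data.List.Membership.Propositional using (_∈_)
open import Data.List.Membership.Propositional.Properties using (∈-allFin)
open import Data.List.Relation.Unary.Any using (here; there)
open import Data.Product using (_×_; _,_; ∃)
open import Data.Sum using (_⊎_; inj₁; inj₂)
open import Data.Empty using (⊥-elim)
open import Function using (_∘_; id)
open import Function.Bundles using (_⇔_; mk⇔; Equivalence)
open import Relation.Nullary using (yes; no; ¬_)
open import Relation.Nullary.Decidable using (⌊_⌋; _×-dec_)
open import Relation.Binary.PropositionalEquality
open ≡-Reasoning
open import Algebra.Properties.CommutativeSemigroup ℕP.+-commutativeSemigroup using ()
  renaming (interchange to +-interchange)

private variable
  X Y : Set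

-- Since derivN (suc i) p = derivN i (deriv p),
-- Balanced c (suc i) p q is by definition Balanced c i (deriv p) (deriv q).
Balanced : ℤ → ℕ → Poly → Poly → Set
Balanced c i p q = ∀ k → c * derivN i p k ≡ onePlusX (derivN (suc i) p) k + derivN i q k

onePlusX-deriv : ∀ p k → onePlusX (deriv p) k ≡ deriv p k + + k * p k
onePlusX-deriv p zero    = begin
  deriv p zero                  ≡⟨ ℤP.+-identityʳ _ ⟨
  deriv p zero + + 0            ≡⟨ cong (λ z → deriv p zero + z) (ℤP.*-zeroˡ (p zero)) ⟨
  deriv p zero + + 0 * p zero   ∎
onePlusX-deriv p (suc k) = refl

-- Differentiating  c·p = (1+x)p′ + q  gives  c·p′ = (1+x)p″ + p′ + q′, i.e.
-- (c-1)·p′ = (1+x)p″ + q′.  Coefficientwise: multiply the relation at k+1 by k+1.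
balanced-deriv : ∀ c p q → Balanced c 0 p q → Balanced (c - + 1) 0 (deriv p) (deriv q)
balanced-deriv c p q bal k = begin
  (c - + 1) * (+ suc k * p (suc k))                                ≡⟨ expand c (+ k) (p (suc k)) ⟩
  (+ 1 + + k) * (c * p (suc k)) - (+ 1 + + k) * p (suc k)          ≡⟨ cong (λ z → (+ 1 + + k) * z - (+ 1 + + k) * p (suc k)) (bal (suc k)) ⟩
  (+ 1 + + k) * (deriv p (suc k) + (+ 1 + + k) * p (suc k) + q (suc k)) - (+ 1 + + k) * p (suc k)
                                                                    ≡⟨ collect (+ k) (deriv p (suc k)) (p (suc k)) (q (suc k)) ⟩
  deriv (deriv p) k + + k * deriv p k + deriv q k                   ≡⟨ cong (_+ deriv q k) (onePlusX-deriv (deriv p) k) ⟨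
  onePlusX (deriv (deriv p)) k + deriv q k                          ∎
  where
  expand : ∀ c k x → (c - + 1) * ((+ 1 + k) * x) ≡ (+ 1 + k) * (c * x) - (+ 1 + k) * x
  expand = solve-∀
  collect : ∀ k d x y → (+ 1 + k) * (d + (+ 1 + k) * x + y) - (+ 1 + k) * x ≡ (+ 1 + k) * d + k * ((+ 1 + k) * x) + (+ 1 + k) * y
  collect = solve-∀

balanced-derivN : ∀ i c p q → Balanced c 0 p q → Balanced (c - + i) i p q
balanced-derivN zero    c p q bal = subst (λ c′ → Balanced c′ 0 p q) (sym (ℤP.+-identityʳ c)) bal
balanced-derivN (suc i) c p q bal =
  subst (λ c′ → Balanced c′ i (deriv p) (deriv q)) (shift c (+ i))
        (balanced-derivN i (c - + 1) (deriv p) (deriv q) (balanced-deriv c p q bal))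
  where
  shift : ∀ c i → c - + 1 - i ≡ c - (+ 1 + i)
  shift = solve-∀

sumOver : List X → (X → ℕ) → ℕ
sumOver []       f = 0
sumOver (x ∷ xs) f = f x ℕ.+ sumOver xs f

sumOver-cong : ∀ xs {f g : X → ℕ} → f ≗ g → sumOver xs f ≡ sumOver xs g
sumOver-cong []       f≗g = refl
sumOver-cong (x ∷ xs) f≗g = cong₂ ℕ._+_ (f≗g x) (sumOver-cong xs f≗g)

sumOver-zero : ∀ (xs : List X) → sumOver xs (λ _ → 0) ≡ 0
sumOver-zero []       = refl
sumOver-zero (x ∷ xs) = sumOver-zero xs

sumOver-+ : ∀ xs (f g : X → ℕ) → sumOver xs (λ x → f x ℕ.+ g x) ≡ sumOver xs f ℕ.+ sumOver xs g
sumOver-+ []       f g = refl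
sumOver-+ (x ∷ xs) f g = begin
  f x ℕ.+ g x ℕ.+ sumOver xs (λ x → f x ℕ.+ g x)     ≡⟨ cong (f x ℕ.+ g x ℕ.+_) (sumOver-+ xs f g) ⟩
  f x ℕ.+ g x ℕ.+ (sumOver xs f ℕ.+ sumOver xs g)    ≡⟨ +-interchange (f x) (g x) _ _ ⟩
  f x ℕ.+ sumOver xs f ℕ.+ (g x ℕ.+ sumOver xs g)    ∎

sumOver-*ˡ : ∀ xs c (f : X → ℕ) → sumOver xs (λ x → c ℕ.* f x) ≡ c ℕ.* sumOver xs f
sumOver-*ˡ []       c f = sym (ℕP.*-zeroʳ c)
sumOver-*ˡ (x ∷ xs) c f = trans (cong (c ℕ.* f x ℕ.+_) (sumOver-*ˡ xs c f)) (sym (ℕP.*-distribˡ-+ c (f x) _))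

sumOver-*ʳ : ∀ xs c (f : X → ℕ) → sumOver xs (λ x → f x ℕ.* c) ≡ sumOver xs f ℕ.* c
sumOver-*ʳ []       c f = refl
sumOver-*ʳ (x ∷ xs) c f = trans (cong (f x ℕ.* c ℕ.+_) (sumOver-*ʳ xs c f)) (sym (ℕP.*-distribʳ-+ c (f x) _))

sumOver-++ : ∀ xs ys (f : X → ℕ) → sumOver (xs ++ ys) f ≡ sumOver xs f ℕ.+ sumOver ys f
sumOver-++ []       ys f = refl
sumOver-++ (x ∷ xs) ys f = trans (cong (f x ℕ.+_) (sumOver-++ xs ys f)) (sym (ℕP.+-assoc (f x) _ _))

sumOver-map : ∀ (h : X → Y) xs (f : Y → ℕ) → sumOver (map h xs) f ≡ sumOver xs (f ∘ h)
sumOver-map h []       f = refl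
sumOver-map h (x ∷ xs) f = cong (f (h x) ℕ.+_) (sumOver-map h xs f)

sumOver-swap : ∀ (xs : List X) (ys : List Y) (f : X → Y → ℕ) →
  sumOver xs (λ x → sumOver ys (f x)) ≡ sumOver ys (λ y → sumOver xs (λ x → f x y))
sumOver-swap []       ys f = sym (sumOver-zero ys)
sumOver-swap (x ∷ xs) ys f = begin
  sumOver ys (f x) ℕ.+ sumOver xs (λ x → sumOver ys (f x))          ≡⟨ cong (sumOver ys (f x) ℕ.+_) (sumOver-swap xs ys f) ⟩
  sumOver ys (f x) ℕ.+ sumOver ys (λ y → sumOver xs (λ x → f x y))  ≡⟨ sumOver-+ ys (f x) _ ⟨
  sumOver ys (λ y → f x y ℕ.+ sumOver xs (λ x → f x y))             ∎

sumOver-allFin-suc : ∀ n (f : Fin (suc n) → ℕ) → sumOver (allFin (suc n)) f ≡ f Fin.zero ℕ.+ sumOver (allFin n) (f ∘ Fin.suc)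
sumOver-allFin-suc n f = cong (f Fin.zero ℕ.+_) (begin
  sumOver (Data.List.tabulate Fin.suc) f        ≡⟨ cong (λ xs → sumOver xs f) (ListP.map-tabulate id Fin.suc) ⟨
  sumOver (map Fin.suc (allFin n)) f            ≡⟨ sumOver-map Fin.suc (allFin n) f ⟩
  sumOver (allFin n) (f ∘ Fin.suc)              ∎)

𝟙 : Bool → ℕ
𝟙 true  = 1
𝟙 false = 0

countL-as-sum : ∀ (p : X → Bool) xs → countL p xs ≡ sumOver xs (𝟙 ∘ p)
countL-as-sum p []       = refl
countL-as-sum p (x ∷ xs) with p x
... | true  = cong suc (countL-as-sum p xs)
... | false = countL-as-sum p xs

if-then-as-product : ∀ b x → (if b then x else 0) ≡ 𝟙 b ℕ.* x
if-then-as-product true  x = sym (ℕP.+-identityʳ x)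
if-then-as-product false x = refl

if-else-as-product : ∀ b x → (if b then 0 else x) ≡ 𝟙 (not b) ℕ.* x
if-else-as-product true  x = refl
if-else-as-product false x = sym (ℕP.+-identityʳ x)

sumSubsets : ∀ n → (VSet n → ℕ) → ℕ
sumSubsets n = sumOver (allSubsets n)

sumSubsets-suc : ∀ n (f : VSet (suc n) → ℕ) →
  sumSubsets (suc n) f ≡ sumSubsets n (f ∘ (false ∷_)) ℕ.+ sumSubsets n (f ∘ (true ∷_))
sumSubsets-suc n f = trans (sumOver-++ (map (false ∷_) (allSubsets n)) _ f)
  (cong₂ ℕ._+_ (sumOver-map (false ∷_) (allSubsets n) f) (sumOver-map (true ∷_) (allSubsets n) f))

card-as-sum : ∀ {n} (W : VSet n) → sumOver (allFin n) (𝟙 ∘ lookup W) ≡ card W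
card-as-sum {zero}  []          = refl
card-as-sum {suc n} (true  ∷ W) = trans (sumOver-allFin-suc n (𝟙 ∘ lookup (true ∷ W))) (cong suc (card-as-sum W))
card-as-sum {suc n} (false ∷ W) = trans (sumOver-allFin-suc n (𝟙 ∘ lookup (false ∷ W))) (card-as-sum W)

cocard-as-sum : ∀ {n} (W : VSet n) → sumOver (allFin n) (𝟙 ∘ not ∘ lookup W) ℕ.+ card W ≡ n
cocard-as-sum {zero}  []          = refl
cocard-as-sum {suc n} (true  ∷ W) = begin
  sumOver (allFin (suc n)) (𝟙 ∘ not ∘ lookup (true ∷ W)) ℕ.+ suc (card W)
    ≡⟨ cong (ℕ._+ suc (card W)) (sumOver-allFin-suc n (𝟙 ∘ not ∘ lookup (true ∷ W))) ⟩
  sumOver (allFin n) (𝟙 ∘ not ∘ lookup W) ℕ.+ suc (card W)  ≡⟨ ℕP.+-suc _ (card W) ⟩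
  suc (sumOver (allFin n) (𝟙 ∘ not ∘ lookup W) ℕ.+ card W)  ≡⟨ cong suc (cocard-as-sum W) ⟩
  suc n                                                      ∎
cocard-as-sum {suc n} (false ∷ W) =
  trans (cong (ℕ._+ card W) (sumOver-allFin-suc n (𝟙 ∘ not ∘ lookup (false ∷ W)))) (cong suc (cocard-as-sum W))

sum-over-members : ∀ n (f : VSet n → ℕ) →
  sumOver (allFin n) (λ v → sumSubsets n (λ W → if lookup W v then f W else 0)) ≡
  sumSubsets n (λ W → card W ℕ.* f W)
sum-over-members n f =
  trans (sumOver-swap (allFin n) (allSubsets n) _) (sumOver-cong (allSubsets n) members)
  where
  members : ∀ W → sumOver (allFin n) (λ v → if lookup W v then f W else 0) ≡ card W ℕ.* f W
  members W = begin
    sumOver (allFin n) (λ v → if lookup W v then f W else 0)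
      ≡⟨ sumOver-cong (allFin n) (λ v → if-then-as-product (lookup W v) (f W)) ⟩
    sumOver (allFin n) (λ v → 𝟙 (lookup W v) ℕ.* f W)    ≡⟨ sumOver-*ʳ (allFin n) (f W) _ ⟩
    sumOver (allFin n) (𝟙 ∘ lookup W) ℕ.* f W             ≡⟨ cong (ℕ._* f W) (card-as-sum W) ⟩
    card W ℕ.* f W                                         ∎

sum-over-nonmembers : ∀ n (f : VSet n → ℕ) →
  sumOver (allFin n) (λ v → sumSubsets n (λ W → if lookup W v then 0 else f W)) ℕ.+
  sumSubsets n (λ W → card W ℕ.* f W) ≡ n ℕ.* sumSubsets n f
sum-over-nonmembers n f = begin
  sumOver (allFin n) (λ v → sumSubsets n (λ W → if lookup W v then 0 else f W)) ℕ.+ sumSubsets n (λ W → card W ℕ.* f W)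
    ≡⟨ cong (ℕ._+ sumSubsets n (λ W → card W ℕ.* f W)) (sumOver-swap (allFin n) (allSubsets n) _) ⟩
  sumSubsets n (λ W → sumOver (allFin n) (λ v → if lookup W v then 0 else f W)) ℕ.+ sumSubsets n (λ W → card W ℕ.* f W)
    ≡⟨ sumOver-+ (allSubsets n) _ _ ⟨
  sumSubsets n (λ W → sumOver (allFin n) (λ v → if lookup W v then 0 else f W) ℕ.+ card W ℕ.* f W)
    ≡⟨ sumOver-cong (allSubsets n) nonmembers ⟩
  sumSubsets n (λ W → n ℕ.* f W)                    ≡⟨ sumOver-*ˡ (allSubsets n) n f ⟩
  n ℕ.* sumSubsets n f                              ∎
  where
  nonmembers : ∀ W → sumOver (allFin n) (λ v → if lookup W v then 0 else f W) ℕ.+ card W ℕ.* f W ≡ n ℕ.* f W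
  nonmembers W = begin
    sumOver (allFin n) (λ v → if lookup W v then 0 else f W) ℕ.+ card W ℕ.* f W
      ≡⟨ cong (ℕ._+ card W ℕ.* f W) (sumOver-cong (allFin n) (λ v → if-else-as-product (lookup W v) (f W))) ⟩
    sumOver (allFin n) (λ v → 𝟙 (not (lookup W v)) ℕ.* f W) ℕ.+ card W ℕ.* f W
      ≡⟨ cong (ℕ._+ card W ℕ.* f W) (sumOver-*ʳ (allFin n) (f W) (𝟙 ∘ not ∘ lookup W)) ⟩
    sumOver (allFin n) (𝟙 ∘ not ∘ lookup W) ℕ.* f W ℕ.+ card W ℕ.* f W
      ≡⟨ ℕP.*-distribʳ-+ (f W) (sumOver (allFin n) (𝟙 ∘ not ∘ lookup W)) (card W) ⟨
    (sumOver (allFin n) (𝟙 ∘ not ∘ lookup W) ℕ.+ card W) ℕ.* f W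
      ≡⟨ cong (ℕ._* f W) (cocard-as-sum W) ⟩
    n ℕ.* f W                                        ∎

-- Adding v is a bijection from the subsets avoiding v onto those containing v.
sum-insert : ∀ n (v : Fin n) (f : VSet n → ℕ) →
  sumSubsets n (λ W → if lookup W v then f W else 0) ≡
  sumSubsets n (λ W → if lookup W v then 0 else f (W [ v ]≔ true))
sum-insert (suc n) Fin.zero f = begin
  sumSubsets (suc n) (λ W → if lookup W Fin.zero then f W else 0)
    ≡⟨ sumSubsets-suc n _ ⟩
  sumSubsets n (λ _ → 0) ℕ.+ sumSubsets n (f ∘ (true ∷_))
    ≡⟨ ℕP.+-comm (sumSubsets n (λ _ → 0)) (sumSubsets n (f ∘ (true ∷_))) ⟩
  sumSubsets n (f ∘ (true ∷_)) ℕ.+ sumSubsets n (λ _ → 0)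
    ≡⟨ sumSubsets-suc n _ ⟨
  sumSubsets (suc n) (λ W → if lookup W Fin.zero then 0 else f (W [ Fin.zero ]≔ true)) ∎
sum-insert (suc n) (Fin.suc v) f = begin
  sumSubsets (suc n) (λ W → if lookup W (Fin.suc v) then f W else 0)
    ≡⟨ sumSubsets-suc n _ ⟩
  sumSubsets n (λ W → if lookup W v then f (false ∷ W) else 0) ℕ.+
  sumSubsets n (λ W → if lookup W v then f (true ∷ W) else 0)
    ≡⟨ cong₂ ℕ._+_ (sum-insert n v (f ∘ (false ∷_))) (sum-insert n v (f ∘ (true ∷_))) ⟩
  sumSubsets n (λ W → if lookup W v then 0 else f (false ∷ W [ v ]≔ true)) ℕ.+
  sumSubsets n (λ W → if lookup W v then 0 else f (true ∷ W [ v ]≔ true))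
    ≡⟨ sumSubsets-suc n _ ⟨
  sumSubsets (suc n) (λ W → if lookup W (Fin.suc v) then 0 else f (W [ Fin.suc v ]≔ true)) ∎

∨-true : ∀ a b → (a ∨ b) ≡ true → a ≡ true ⊎ b ≡ true
∨-true true  b _ = inj₁ refl
∨-true false b e = inj₂ e

∨-introˡ : ∀ {a} b → a ≡ true → (a ∨ b) ≡ true
∨-introˡ b refl = refl

∨-introʳ : ∀ a {b} → b ≡ true → (a ∨ b) ≡ true
∨-introʳ a refl = ∨-zeroʳ a

implies : ∀ a {b} → (not a ∨ b) ≡ true → a ≡ true → b ≡ true
implies true e refl = e

bool-ext : ∀ {b c} → (b ≡ true → c ≡ true) → (c ≡ true → b ≡ true) → b ≡ c
bool-ext {true}  {true}  _ _ = refl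
bool-ext {true}  {false} f _ = sym (f refl)
bool-ext {false} {true}  _ g = g refl
bool-ext {false} {false} _ _ = refl

≟-sound : ∀ {n} (u w : Fin n) → ⌊ u ≟ w ⌋ ≡ true → u ≡ w
≟-sound u w e with u ≟ w
... | yes u≡w = u≡w

≟-refl : ∀ {n} (u : Fin n) → ⌊ u ≟ u ⌋ ≡ true
≟-refl u with u ≟ u
... | yes _   = refl
... | no u≢u = ⊥-elim (u≢u refl)

≟-false : ∀ {n} (u w : Fin n) → u ≢ w → ⌊ u ≟ w ⌋ ≡ false
≟-false u w u≢w with u ≟ w
... | yes u≡w = ⊥-elim (u≢w u≡w)
... | no _    = refl

allL-sound : ∀ (p : X → Bool) xs → allL p xs ≡ true → ∀ {x} → x ∈ xs → p x ≡ true
allL-sound p (y ∷ xs) e (here refl) = ∧-conicalˡ (p y) _ e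
allL-sound p (y ∷ xs) e (there x∈) = allL-sound p xs (∧-conicalʳ (p y) _ e) x∈

allL-complete : ∀ (p : X → Bool) xs → (∀ x → p x ≡ true) → allL p xs ≡ true
allL-complete p []       h = refl
allL-complete p (y ∷ xs) h rewrite h y = allL-complete p xs h

anyL-sound : ∀ (p : X → Bool) xs → anyL p xs ≡ true → ∃ λ x → p x ≡ true
anyL-sound p (y ∷ xs) e with ∨-true (p y) _ e
... | inj₁ py = y , py
... | inj₂ e′ = anyL-sound p xs e′

anyL-complete : ∀ (p : X → Bool) xs {x} → x ∈ xs → p x ≡ true → anyL p xs ≡ true
anyL-complete p (y ∷ xs) (here refl) px = ∨-introˡ _ px
anyL-complete p (y ∷ xs) (there x∈) px = ∨-introʳ (p y) (anyL-complete p xs x∈ px)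

_∈ᵥ_ : ∀ {n} → Fin n → VSet n → Set
u ∈ᵥ W = lookup W u ≡ true

record Dominates {n} (a : Adj n) (S W : VSet n) : Set where
  constructor dominates
  field
    within : ∀ u → u ∈ᵥ W → u ∈ᵥ S
    covers : ∀ u → u ∈ᵥ S → ∃ λ w → w ∈ᵥ W × (u ≡ w ⊎ a u w ≡ true)

isDominating-sound : ∀ {n} (a : Adj n) S W → isDominating a S W ≡ true → Dominates a S W
isDominating-sound {n} a S W e = dominates within covers
  where
  within : ∀ u → u ∈ᵥ W → u ∈ᵥ S
  within u = implies (lookup W u) (allL-sound _ (allFin n) (∧-conicalˡ _ _ e) (∈-allFin u))
  covers : ∀ u → u ∈ᵥ S → ∃ λ w → w ∈ᵥ W × (u ≡ w ⊎ a u w ≡ true)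
  covers u u∈S with anyL-sound _ (allFin n)
                      (implies (lookup S u) (allL-sound _ (allFin n) (∧-conicalʳ _ _ e) (∈-allFin u)) u∈S)
  ... | w , e′ with ∨-true ⌊ u ≟ w ⌋ (a u w) (∧-conicalʳ (lookup W w) _ e′)
  ... | inj₁ u≟w = w , ∧-conicalˡ (lookup W w) _ e′ , inj₁ (≟-sound u w u≟w)
  ... | inj₂ uw  = w , ∧-conicalˡ (lookup W w) _ e′ , inj₂ uw

isDominating-complete : ∀ {n} (a : Adj n) S W → Dominates a S W → isDominating a S W ≡ true
isDominating-complete {n} a S W (dominates within covers) =
  cong₂ _∧_ (allL-complete _ (allFin n) inside) (allL-complete _ (allFin n) covered)
  where
  inside : ∀ u → (not (lookup W u) ∨ lookup S u) ≡ true
  inside u with lookup W u in u∈W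
  ... | true  = within u u∈W
  ... | false = refl
  witness : ∀ u w → w ∈ᵥ W → u ≡ w ⊎ a u w ≡ true → (lookup W w ∧ (⌊ u ≟ w ⌋ ∨ a u w)) ≡ true
  witness u w w∈W r rewrite w∈W with r
  ... | inj₁ refl = ∨-introˡ (a u u) (≟-refl u)
  ... | inj₂ uw   = ∨-introʳ ⌊ u ≟ w ⌋ uw
  covered : ∀ u → (not (lookup S u) ∨ anyL (λ w → lookup W w ∧ (⌊ u ≟ w ⌋ ∨ a u w)) (allFin n)) ≡ true
  covered u with lookup S u in u∈S
  ... | false = refl
  ... | true with covers u u∈S
  ... | w , w∈W , r = anyL-complete _ (allFin n) (∈-allFin w) (witness u w w∈W r)

isDominating-cong : ∀ {n} {a a′ : Adj n} {S S′ W W′} → Dominates a S W ⇔ Dominates a′ S′ W′ →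
                    isDominating a S W ≡ isDominating a′ S′ W′
isDominating-cong {a = a} {a′} {S} {S′} {W} {W′} eqv =
  bool-ext (isDominating-complete a′ S′ W′ ∘ Equivalence.to eqv ∘ isDominating-sound a S W)
           (isDominating-complete a S W ∘ Equivalence.from eqv ∘ isDominating-sound a′ S′ W′)

isDominating-false : ∀ {n} {a : Adj n} {S W} → ¬ Dominates a S W → isDominating a S W ≡ false
isDominating-false {a = a} {S} {W} ¬dom = ¬-not (¬dom ∘ isDominating-sound a S W)

¬dominates-outside : ∀ {n} {a : Adj n} {S W} u → u ∈ᵥ W → lookup S u ≡ false → ¬ Dominates a S W
¬dominates-outside u u∈W u∉S dom with trans (sym (Dominates.within dom u u∈W)) u∉S
... | ()

Vall : ∀ {n} → VSet n
Vall {n} = replicate n true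

∈Vall : ∀ {n} (u : Fin n) → u ∈ᵥ Vall
∈Vall u = VecP.lookup-replicate u true

domOfSize : ∀ {n} → Adj n → VSet n → ℕ → VSet n → ℕ
domOfSize a S k W = 𝟙 (isDominating a S W ∧ (card W ==ℕ k))

domCount : ∀ {n} → Adj n → VSet n → ℕ → ℕ
domCount {n} a S k = countL (λ W → isDominating a S W ∧ (card W ==ℕ k)) (allSubsets n)

domCount-as-sum : ∀ {n} (a : Adj n) S k → domCount a S k ≡ sumSubsets n (domOfSize a S k)
domCount-as-sum {n} a S k = countL-as-sum _ (allSubsets n)

==ℕ-sound : ∀ c k → (c ==ℕ k) ≡ true → c ≡ k
==ℕ-sound zero    zero    _ = refl
==ℕ-sound (suc c) (suc k) e = cong suc (==ℕ-sound c k e)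

card-domOfSize : ∀ {n} (a : Adj n) S k W → card W ℕ.* domOfSize a S k W ≡ k ℕ.* domOfSize a S k W
card-domOfSize a S k W with card W ==ℕ k in size
... | true  = cong (ℕ._* 𝟙 (isDominating a S W ∧ true)) (==ℕ-sound (card W) k size)
... | false rewrite ∧-zeroʳ (isDominating a S W) | ℕP.*-zeroʳ (card W) | ℕP.*-zeroʳ k = refl

card-insert : ∀ {n} (v : Fin n) W → lookup W v ≡ false → card (W [ v ]≔ true) ≡ suc (card W)
card-insert Fin.zero    (false ∷ W) _ = refl
card-insert (Fin.suc v) (true  ∷ W) e = cong suc (card-insert v W e)
card-insert (Fin.suc v) (false ∷ W) e = card-insert v W e

restrict : ∀ x y z t u q → 𝟙 x ℕ.+ 𝟙 y ≡ 𝟙 z ℕ.+ 𝟙 t ℕ.+ 𝟙 u →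
           𝟙 (x ∧ q) ℕ.+ 𝟙 (y ∧ q) ≡ 𝟙 (z ∧ q) ℕ.+ 𝟙 (t ∧ q) ℕ.+ 𝟙 (u ∧ q)
restrict x y z t u true  e
  rewrite ∧-identityʳ x | ∧-identityʳ y | ∧-identityʳ z | ∧-identityʳ t | ∧-identityʳ u = e
restrict x y z t u false e
  rewrite ∧-zeroʳ x | ∧-zeroʳ y | ∧-zeroʳ z | ∧-zeroʳ t | ∧-zeroʳ u = refl

domOfSize-outside : ∀ {n} (a : Adj n) S W k u → u ∈ᵥ W → lookup S u ≡ false → domOfSize a S k W ≡ 0
domOfSize-outside a S W k u u∈W u∉S =
  cong (λ b → 𝟙 (b ∧ (card W ==ℕ k))) (isDominating-false (¬dominates-outside {a = a} {S} {W} u u∈W u∉S))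

domOfSize-insert : ∀ {n} (a : Adj n) S k v W → lookup W v ≡ false →
  domOfSize a S (suc k) (W [ v ]≔ true) ≡ 𝟙 (isDominating a S (W [ v ]≔ true) ∧ (card W ==ℕ k))
domOfSize-insert a S k v W v∉W = cong (λ c → 𝟙 (isDominating a S (W [ v ]≔ true) ∧ (c ==ℕ suc k))) (card-insert v W v∉W)

module AtVertex {n} (G : SimpleGraph n) (v : Fin n) where

  Vdel VdelN : VSet n
  Vdel  = tabulate (λ u → not ⌊ u ≟ v ⌋)
  VdelN = tabulate (λ u → not (⌊ u ≟ v ⌋ ∨ adj G u v))

  ∈Vdel : ∀ u → u ≢ v → u ∈ᵥ Vdel
  ∈Vdel u u≢v rewrite VecP.lookup∘tabulate (λ u → not ⌊ u ≟ v ⌋) u | ≟-false u v u≢v = refl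

  v∉Vdel : lookup Vdel v ≡ false
  v∉Vdel rewrite VecP.lookup∘tabulate (λ u → not ⌊ u ≟ v ⌋) v | ≟-refl v = refl

  ∈VdelN : ∀ u → u ≢ v → adj G u v ≡ false → u ∈ᵥ VdelN
  ∈VdelN u u≢v uv rewrite VecP.lookup∘tabulate (λ u → not (⌊ u ≟ v ⌋ ∨ adj G u v)) u | ≟-false u v u≢v | uv = refl

  ∈VdelN⁻ : ∀ u → u ∈ᵥ VdelN → adj G u v ≡ false
  ∈VdelN⁻ u e rewrite VecP.lookup∘tabulate (λ u → not (⌊ u ≟ v ⌋ ∨ adj G u v)) u with ⌊ u ≟ v ⌋ | adj G u v
  ... | false | false = refl

  v∉VdelN : lookup VdelN v ≡ false
  v∉VdelN rewrite VecP.lookup∘tabulate (λ u → not (⌊ u ≟ v ⌋ ∨ adj G u v)) v | ≟-refl v = refl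

  contract-⊇ : ∀ {u w} → adj G u w ≡ true → contractAdj G v u w ≡ true
  contract-⊇ = ∨-introˡ _

  contract-edge : ∀ {u w} → adj G u v ≡ true → adj G w v ≡ true → u ≢ w → contractAdj G v u w ≡ true
  contract-edge {u} {w} uv wv u≢w rewrite uv | wv | ≟-false u w u≢w = ∨-zeroʳ (adj G u w)

  contract-edge⁻ : ∀ u w → contractAdj G v u w ≡ true → adj G u w ≡ true ⊎ (adj G u v ≡ true × adj G w v ≡ true)
  contract-edge⁻ u w e with ∨-true (adj G u w) _ e
  ... | inj₁ uw = inj₁ uw
  ... | inj₂ e′ = inj₂ (∧-conicalˡ (adj G u v) _ e′ , ∧-conicalˡ (adj G w v) _ (∧-conicalʳ (adj G u v) _ e′))

  _+v : VSet n → VSet n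
  W +v = W [ v ]≔ true

  v∈W+v : ∀ W → v ∈ᵥ (W +v)
  v∈W+v W = VecP.lookup∘update v W true

  +v-other : ∀ W {u} → u ≢ v → lookup (W +v) u ≡ lookup W u
  +v-other W u≢v = VecP.lookup∘update′ u≢v W true

  +v-⊇ : ∀ W {u} → u ∈ᵥ W → u ∈ᵥ (W +v)
  +v-⊇ W {u} u∈W with u ≟ v
  ... | yes refl = v∈W+v W
  ... | no u≢v   = trans (+v-other W u≢v) u∈W

  module Local (W : VSet n) (v∉W : lookup W v ≡ false) where

    ≢v : ∀ {u} → u ∈ᵥ W → u ≢ v
    ≢v u∈W refl with trans (sym u∈W) v∉W
    ... | ()

    module Meets (h : Fin n) (h∈W : h ∈ᵥ W) (vh : adj G v h ≡ true) where

      hv : adj G h v ≡ true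
      hv = trans (SimpleGraph.sym G h v) vh

      -- v is dominated by h anyway, so W dominates G iff it dominates G - v.
      G⇔G-v : Dominates (adj G) Vall W ⇔ Dominates (adj G) Vdel W
      G⇔G-v = mk⇔ to from
        where
        to : Dominates (adj G) Vall W → Dominates (adj G) Vdel W
        to (dominates _ covers) = dominates (λ u → ∈Vdel u ∘ ≢v) (λ u _ → covers u (∈Vall u))
        from : Dominates (adj G) Vdel W → Dominates (adj G) Vall W
        from (dominates _ covers) = dominates (λ u _ → ∈Vall u) covers′
          where
          covers′ : ∀ u → u ∈ᵥ Vall → ∃ λ w → w ∈ᵥ W × (u ≡ w ⊎ adj G u w ≡ true)
          covers′ u _ with u ≟ v
          ... | yes refl = h , h∈W , inj₂ vh
          ... | no u≢v   = covers u (∈Vdel u u≢v)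

      -- A neighbour u of v is dominated in G / v by h, and in G by v.
      G/v⇔W+v : Dominates (contractAdj G v) Vdel W ⇔ Dominates (adj G) Vall (W +v)
      G/v⇔W+v = mk⇔ to from
        where
        to : Dominates (contractAdj G v) Vdel W → Dominates (adj G) Vall (W +v)
        to (dominates _ covers) = dominates (λ u _ → ∈Vall u) covers′
          where
          covers′ : ∀ u → u ∈ᵥ Vall → ∃ λ w → w ∈ᵥ (W +v) × (u ≡ w ⊎ adj G u w ≡ true)
          covers′ u _ with u ≟ v
          ... | yes refl = v , v∈W+v W , inj₁ refl
          ... | no u≢v with covers u (∈Vdel u u≢v)
          ... | w , w∈W , inj₁ u≡w = w , +v-⊇ W w∈W , inj₁ u≡w
          ... | w , w∈W , inj₂ uw with contract-edge⁻ u w uw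
          ... | inj₁ uw′       = w , +v-⊇ W w∈W , inj₂ uw′
          ... | inj₂ (uv , _)  = v , v∈W+v W , inj₂ uv
        from : Dominates (adj G) Vall (W +v) → Dominates (contractAdj G v) Vdel W
        from (dominates _ covers) = dominates (λ u → ∈Vdel u ∘ ≢v) covers′
          where
          covers′ : ∀ u → u ∈ᵥ Vdel → ∃ λ w → w ∈ᵥ W × (u ≡ w ⊎ contractAdj G v u w ≡ true)
          covers′ u u∈Vdel with covers u (∈Vall u)
          ... | w , w∈W+v , r with w ≟ v
          covers′ u u∈Vdel | w , _ , inj₁ refl | yes refl with trans (sym u∈Vdel) v∉Vdel
          ... | ()
          covers′ u u∈Vdel | w , _ , inj₂ uv | yes refl with u ≟ h
          ... | yes u≡h = h , h∈W , inj₁ u≡h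
          ... | no u≢h  = h , h∈W , inj₂ (contract-edge uv hv u≢h)
          covers′ u u∈Vdel | w , w∈W+v , r | no w≢v with trans (sym (+v-other W w≢v)) w∈W+v | r
          ... | w∈W | inj₁ u≡w = w , w∈W , inj₁ u≡w
          ... | w∈W | inj₂ uw  = w , w∈W , inj₂ (contract-⊇ uw)

      -- h ∈ W lies outside G - N[v].
      ¬G-N[v] : ¬ Dominates (adj G) VdelN W
      ¬G-N[v] dom with trans (sym hv) (∈VdelN⁻ h (Dominates.within dom h h∈W))
      ... | ()

    module Misses (miss : ∀ w → w ∈ᵥ W → adj G v w ≡ false) where

      -- Nothing dominates v.
      ¬G : ¬ Dominates (adj G) Vall W
      ¬G (dominates _ covers) with covers v (∈Vall v)
      ... | w , w∈W , inj₁ refl with trans (sym w∈W) v∉W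
      ... | ()
      ¬G (dominates _ covers) | w , w∈W , inj₂ vw with trans (sym vw) (miss w w∈W)
      ... | ()

      -- The edges added in G / v end in N(v), which W avoids.
      G/v⇔G-v : Dominates (contractAdj G v) Vdel W ⇔ Dominates (adj G) Vdel W
      G/v⇔G-v = mk⇔ to from
        where
        to : Dominates (contractAdj G v) Vdel W → Dominates (adj G) Vdel W
        to (dominates within covers) = dominates within covers′
          where
          covers′ : ∀ u → u ∈ᵥ Vdel → ∃ λ w → w ∈ᵥ W × (u ≡ w ⊎ adj G u w ≡ true)
          covers′ u u∈Vdel with covers u u∈Vdel
          ... | w , w∈W , inj₁ u≡w = w , w∈W , inj₁ u≡w
          ... | w , w∈W , inj₂ uw with contract-edge⁻ u w uw
          ... | inj₁ uw′       = w , w∈W , inj₂ uw′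
          ... | inj₂ (_ , wv) with trans (sym (trans (SimpleGraph.sym G v w) wv)) (miss w w∈W)
          ... | ()
        from : Dominates (adj G) Vdel W → Dominates (contractAdj G v) Vdel W
        from (dominates within covers) = dominates within covers′
          where
          covers′ : ∀ u → u ∈ᵥ Vdel → ∃ λ w → w ∈ᵥ W × (u ≡ w ⊎ contractAdj G v u w ≡ true)
          covers′ u u∈Vdel with covers u u∈Vdel
          ... | w , w∈W , inj₁ u≡w = w , w∈W , inj₁ u≡w
          ... | w , w∈W , inj₂ uw  = w , w∈W , inj₂ (contract-⊇ uw)

      -- In W + v the vertex v dominates exactly N[v]; the rest must be dominated by W.
      W+v⇔G-N[v] : Dominates (adj G) Vall (W +v) ⇔ Dominates (adj G) VdelN W
      W+v⇔G-N[v] = mk⇔ to from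
        where
        to : Dominates (adj G) Vall (W +v) → Dominates (adj G) VdelN W
        to (dominates _ covers) =
          dominates (λ u u∈W → ∈VdelN u (≢v u∈W) (trans (SimpleGraph.sym G u v) (miss u u∈W))) covers′
          where
          covers′ : ∀ u → u ∈ᵥ VdelN → ∃ λ w → w ∈ᵥ W × (u ≡ w ⊎ adj G u w ≡ true)
          covers′ u u∈VdelN with covers u (∈Vall u)
          ... | w , w∈W+v , r with w ≟ v
          covers′ u u∈VdelN | w , _ , inj₁ refl | yes refl with trans (sym u∈VdelN) v∉VdelN
          ... | ()
          covers′ u u∈VdelN | w , _ , inj₂ uv | yes refl with trans (sym uv) (∈VdelN⁻ u u∈VdelN)
          ... | ()
          covers′ u u∈VdelN | w , w∈W+v , r | no w≢v = w , trans (sym (+v-other W w≢v)) w∈W+v , r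
        from : Dominates (adj G) VdelN W → Dominates (adj G) Vall (W +v)
        from (dominates _ covers) = dominates (λ u _ → ∈Vall u) covers′
          where
          covers′ : ∀ u → u ∈ᵥ Vall → ∃ λ w → w ∈ᵥ (W +v) × (u ≡ w ⊎ adj G u w ≡ true)
          covers′ u _ with u ≟ v
          ... | yes refl = v , v∈W+v W , inj₁ refl
          ... | no u≢v with adj G u v in uv
          ... | true  = v , v∈W+v W , inj₂ uv
          ... | false with covers u (∈VdelN u u≢v uv)
          ... | w , w∈W , r = w , +v-⊇ W w∈W , r

    avoids : ¬ (∃ λ w → w ∈ᵥ W × adj G v w ≡ true) → ∀ w → w ∈ᵥ W → adj G v w ≡ false
    avoids ¬meets w w∈W = ¬-not (λ vw → ¬meets (w , w∈W , vw))

    localIdentity :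
      𝟙 (isDominating (adj G) Vdel W) ℕ.+ 𝟙 (isDominating (adj G) Vall (W +v)) ≡
      𝟙 (isDominating (contractAdj G v) Vdel W) ℕ.+ 𝟙 (isDominating (adj G) VdelN W) ℕ.+
      𝟙 (isDominating (adj G) Vall W)
    localIdentity with FinP.any? (λ w → (lookup W w Bool.≟ true) ×-dec (adj G v w Bool.≟ true))
    ... | yes (h , h∈W , vh)
      rewrite isDominating-cong (Meets.G⇔G-v h h∈W vh)
            | isDominating-cong (Meets.G/v⇔W+v h h∈W vh)
            | isDominating-false (Meets.¬G-N[v] h h∈W vh)
      = swap (𝟙 (isDominating (adj G) Vdel W)) (𝟙 (isDominating (adj G) Vall (W +v)))
      where
      swap : ∀ x y → x ℕ.+ y ≡ y ℕ.+ 0 ℕ.+ x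
      swap = ℕ-solve
    ... | no ¬meets
      rewrite isDominating-false (Misses.¬G (avoids ¬meets))
            | isDominating-cong (Misses.G/v⇔G-v (avoids ¬meets))
            | isDominating-cong (Misses.W+v⇔G-N[v] (avoids ¬meets))
      = sym (ℕP.+-identityʳ _)

  -- The local identity for sets of size m; for W ∋ v all the terms vanish, since v ∉ V(G-v) ⊇ V(G-N[v]).
  sizedIdentity : ∀ m W →
    domOfSize (adj G) Vdel m W ℕ.+ (if lookup W v then 0 else domOfSize (adj G) Vall (suc m) (W +v)) ≡
    domOfSize (contractAdj G v) Vdel m W ℕ.+ domOfSize (adj G) VdelN m W ℕ.+
    (if lookup W v then 0 else domOfSize (adj G) Vall m W)
  sizedIdentity m W with lookup W v in v∈W
  ... | true
    = trans (cong (ℕ._+ 0) (domOfSize-outside (adj G) Vdel W m v v∈W v∉Vdel))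
            (sym (cong₂ (λ x y → x ℕ.+ y ℕ.+ 0) (domOfSize-outside (contractAdj G v) Vdel W m v v∈W v∉Vdel)
                                               (domOfSize-outside (adj G) VdelN W m v v∈W v∉VdelN)))
  ... | false rewrite domOfSize-insert (adj G) Vall m v W v∈W =
    restrict (isDominating (adj G) Vdel W) (isDominating (adj G) Vall (W +v))
             (isDominating (contractAdj G v) Vdel W) (isDominating (adj G) VdelN W) (isDominating (adj G) Vall W)
             (card W ==ℕ m) (Local.localIdentity W v∈W)

  vertexIdentity : ∀ m →
    domCount (adj G) Vdel m ℕ.+ sumSubsets n (λ W → if lookup W v then domOfSize (adj G) Vall (suc m) W else 0) ≡
    domCount (contractAdj G v) Vdel m ℕ.+ domCount (adj G) VdelN m ℕ.+
    sumSubsets n (λ W → if lookup W v then 0 else domOfSize (adj G) Vall m W)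
  vertexIdentity m = begin
    domCount (adj G) Vdel m ℕ.+ sumSubsets n (λ W → if lookup W v then domOfSize (adj G) Vall (suc m) W else 0)
      ≡⟨ cong₂ ℕ._+_ (domCount-as-sum (adj G) Vdel m) (sum-insert n v (domOfSize (adj G) Vall (suc m))) ⟩
    sumSubsets n (domOfSize (adj G) Vdel m) ℕ.+ sumSubsets n inserted
      ≡⟨ sumOver-+ (allSubsets n) _ inserted ⟨
    sumSubsets n (λ W → domOfSize (adj G) Vdel m W ℕ.+ inserted W)
      ≡⟨ sumOver-cong (allSubsets n) (sizedIdentity m) ⟩
    sumSubsets n (λ W → domOfSize (contractAdj G v) Vdel m W ℕ.+ domOfSize (adj G) VdelN m W ℕ.+ avoiding W)
      ≡⟨ sumOver-+ (allSubsets n) _ avoiding ⟩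
    sumSubsets n (λ W → domOfSize (contractAdj G v) Vdel m W ℕ.+ domOfSize (adj G) VdelN m W) ℕ.+ sumSubsets n avoiding
      ≡⟨ cong (ℕ._+ sumSubsets n avoiding) (sumOver-+ (allSubsets n) _ _) ⟩
    sumSubsets n (domOfSize (contractAdj G v) Vdel m) ℕ.+ sumSubsets n (domOfSize (adj G) VdelN m) ℕ.+ sumSubsets n avoiding
      ≡⟨ cong (λ x → x ℕ.+ sumSubsets n avoiding)
              (sym (cong₂ ℕ._+_ (domCount-as-sum (contractAdj G v) Vdel m) (domCount-as-sum (adj G) VdelN m))) ⟩
    domCount (contractAdj G v) Vdel m ℕ.+ domCount (adj G) VdelN m ℕ.+ sumSubsets n avoiding ∎
    where
    inserted avoiding : VSet n → ℕ
    inserted W = if lookup W v then 0 else domOfSize (adj G) Vall (suc m) (W +v)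
    avoiding W = if lookup W v then 0 else domOfSize (adj G) Vall m W

size-weighted-count : ∀ {n} (a : Adj n) S k → sumSubsets n (λ W → card W ℕ.* domOfSize a S k W) ≡ k ℕ.* domCount a S k
size-weighted-count {n} a S k = begin
  sumSubsets n (λ W → card W ℕ.* domOfSize a S k W)   ≡⟨ sumOver-cong (allSubsets n) (card-domOfSize a S k) ⟩
  sumSubsets n (λ W → k ℕ.* domOfSize a S k W)        ≡⟨ sumOver-*ˡ (allSubsets n) k (domOfSize a S k) ⟩
  k ℕ.* sumSubsets n (domOfSize a S k)                ≡⟨ cong (k ℕ.*_) (domCount-as-sum a S k) ⟨
  k ℕ.* domCount a S k                                ∎

members-count : ∀ {n} (a : Adj n) S k →
  sumOver (allFin n) (λ v → sumSubsets n (λ W → if lookup W v then domOfSize a S k W else 0)) ≡ k ℕ.* domCount a S k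
members-count {n} a S k = trans (sum-over-members n (domOfSize a S k)) (size-weighted-count a S k)

nonmembers-count : ∀ {n} (a : Adj n) S k →
  sumOver (allFin n) (λ v → sumSubsets n (λ W → if lookup W v then 0 else domOfSize a S k W)) ℕ.+
  k ℕ.* domCount a S k ≡ n ℕ.* domCount a S k
nonmembers-count {n} a S k = begin
  avoiding ℕ.+ k ℕ.* domCount a S k                            ≡⟨ cong (avoiding ℕ.+_) (size-weighted-count a S k) ⟨
  avoiding ℕ.+ sumSubsets n (λ W → card W ℕ.* domOfSize a S k W) ≡⟨ sum-over-nonmembers n (domOfSize a S k) ⟩
  n ℕ.* sumSubsets n (domOfSize a S k)                         ≡⟨ cong (n ℕ.*_) (domCount-as-sum a S k) ⟨
  n ℕ.* domCount a S k                                         ∎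
  where
  avoiding : ℕ
  avoiding = sumOver (allFin n) (λ v → sumSubsets n (λ W → if lookup W v then 0 else domOfSize a S k W))

balance-ℤ : ∀ a x c e y → a ℕ.+ x ≡ c ℕ.+ e ℕ.+ y → + a - + c - + e ≡ + y - + x
balance-ℤ a x c e y eq = begin
  + a - + c - + e                      ≡⟨ add-subtract (+ a) (+ x) (+ c) (+ e) ⟩
  (+ a + + x) - + c - + e - + x        ≡⟨ cong (λ z → z - + c - + e - + x) (ℤP.pos-+ a x) ⟨
  + (a ℕ.+ x) - + c - + e - + x        ≡⟨ cong (λ z → + z - + c - + e - + x) eq ⟩
  + (c ℕ.+ e ℕ.+ y) - + c - + e - + x  ≡⟨ cong (λ z → z - + c - + e - + x) (trans (ℤP.pos-+ (c ℕ.+ e) y) (cong (_+ + y) (ℤP.pos-+ c e))) ⟩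
  (+ c + + e + + y) - + c - + e - + x  ≡⟨ cancel (+ c) (+ e) (+ y) (+ x) ⟩
  + y - + x                            ∎
  where
  add-subtract : ∀ a x c e → a - c - e ≡ (a + x) - c - e - x
  add-subtract = solve-∀
  cancel : ∀ c e y x → (c + e + y) - c - e - x ≡ y - x
  cancel = solve-∀

foldr-differences : ∀ (xs : List X) (f : X → ℤ) (p q : X → ℕ) → (∀ x → f x ≡ + p x - + q x) →
  foldr (λ x acc → f x + acc) (+ 0) xs ≡ + sumOver xs p - + sumOver xs q
foldr-differences []       f p q e = refl
foldr-differences (x ∷ xs) f p q e = begin
  f x + foldr (λ x acc → f x + acc) (+ 0) xs                 ≡⟨ cong₂ _+_ (e x) (foldr-differences xs f p q e) ⟩
  (+ p x - + q x) + (+ sumOver xs p - + sumOver xs q)        ≡⟨ regroup (+ p x) (+ q x) (+ sumOver xs p) (+ sumOver xs q) ⟩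
  (+ p x + + sumOver xs p) - (+ q x + + sumOver xs q)        ≡⟨ cong₂ _-_ (ℤP.pos-+ (p x) _) (ℤP.pos-+ (q x) _) ⟨
  + sumOver (x ∷ xs) p - + sumOver (x ∷ xs) q                ∎
  where
  regroup : ∀ a b c d → a - b + (c - d) ≡ a + c - (b + d)
  regroup = solve-∀

module Coefficients {n} (G : SimpleGraph n) (m : ℕ) where

  containing avoiding : Fin n → ℕ
  containing v = sumSubsets n (λ W → if lookup W v then domOfSize (adj G) Vall (suc m) W else 0)
  avoiding   v = sumSubsets n (λ W → if lookup W v then 0 else domOfSize (adj G) Vall m W)

  summand : ∀ v → D-del G v m - D-con G v m - D-delN G v m ≡ + avoiding v - + containing v
  summand v = balance-ℤ (domCount (adj G) Vdel m) (containing v) (domCount (contractAdj G v) Vdel m)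
                        (domCount (adj G) VdelN m) (avoiding v) (AtVertex.vertexIdentity G v m)
    where open AtVertex G v using (Vdel; VdelN)

  A-as-difference : A G m ≡ + sumOver (allFin n) avoiding - + sumOver (allFin n) containing
  A-as-difference = foldr-differences (allFin n) _ avoiding containing summand

  coefficientIdentity : + n * D G m ≡ + suc m * D G (suc m) + + m * D G m + A G m
  coefficientIdentity = begin
    + n * + d                                        ≡⟨ ℤP.pos-* n d ⟨
    + (n ℕ.* d)                                      ≡⟨ cong +_ (nonmembers-count (adj G) Vall m) ⟨
    + (Σavoiding ℕ.+ m ℕ.* d)                        ≡⟨ trans (ℤP.pos-+ Σavoiding (m ℕ.* d)) (cong (λ z → + Σavoiding + z) (ℤP.pos-* m d)) ⟩
    + Σavoiding + + m * + d                          ≡⟨ regroup (+ Σavoiding) (+ m * + d) (+ Σcontaining) ⟩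
    + Σcontaining + + m * + d + (+ Σavoiding - + Σcontaining)
      ≡⟨ cong₂ (λ x z → x + + m * + d + z)
               (trans (cong +_ (members-count (adj G) Vall (suc m))) (ℤP.pos-* (suc m) d′))
               (sym A-as-difference) ⟩
    + suc m * + d′ + + m * + d + A G m                ∎
    where
    d d′ Σavoiding Σcontaining : ℕ
    d = domCount (adj G) Vall m
    d′ = domCount (adj G) Vall (suc m)
    Σavoiding = sumOver (allFin n) avoiding
    Σcontaining = sumOver (allFin n) containing
    regroup : ∀ y t x → y + t ≡ x + t + (y - x)
    regroup = solve-∀

mainTheorem6 : (n : ℕ) (G : SimpleGraph n) (i : ℕ) → i ≢ n → (k : ℕ) →
    (+ n - + i) * derivN i (D G) k ≡ onePlusX (derivN (suc i) (D G)) k + derivN i (A G) k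
mainTheorem6 n G i _ = balanced-derivN i (+ n) (D G) (A G) balanced
  where
  balanced : Balanced (+ n) 0 (D G) (A G)
  balanced k = begin
    + n * D G k                                      ≡⟨ Coefficients.coefficientIdentity G k ⟩
    deriv (D G) k + + k * D G k + A G k             ≡⟨ cong (_+ A G k) (onePlusX-deriv (D G) k) ⟨
    onePlusX (deriv (D G)) k + A G k                 ∎
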